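{- Let $\mathcal P$ be a set of pre-tangles in a graph $G$, and let $N$ be a nested set of $\mathcal P$-relevant proper separations of $G$ which efficiently distinguishes $\mathcal P$. Let $((A_i,B_i))_{i\in\mathbb N}$ be a strictly increasing sequence in $\vec N$ such that the orders $|A_i\cap B_i|$ are strictly increasing. Then there exists a strictly increasing sequence in $\vec N$ which contains $((A_i,B_i))_{i}$ as a subsequence and is strongly $\mathcal P$-relevant.
   Context: A separation of a graph $G$ is an unordered pair $\{A,B\}$ of subsets of $V(G)$ with $A\cup B=V(G)$ and no edge between $A\setminus B$ and $B\setminus A$; its order is $|A\cap B|$; it is proper if $A\ne V(G)\ne B$. Its orientations are $(A,B),(B,A)$; $\vec N$ is the set of all orientations of elements of $N$. Oriented separations are ordered by $(A,B)\le(C,D)$ iff $A\subseteq C$ and $B\supseteq D$. Separations are nested if they have comparable orientations; a set is nested if pairwise nested. A set $O$ of oriented separations is consistent if there are no $(A,B),(C,D)\in O$ with $\{A,B\}\ne\{C,D\}$ and $(B,A)\le(C,D)$. A pre-tangle in $G$ is a set $P$ which, for some $k\in\mathbb N\cup\{\aleph_0\}$, is a consistent set containing exactly one orientation of each separation of $G$ of order less than $k$. A separation distinguishes two pre-tangles if both contain one of its orientations but not the same one, and does so efficiently if it has minimum order among all separations of $G$ distinguishing them. $N$ efficiently distinguishes $\mathcal P$ if any two pre-tangles in $\mathcal P$ distinguished by some separation of $G$ are efficiently distinguished by some element of $N$; a separation is $\mathcal P$-relevant if it efficiently distinguishes some two pre-tangles in $\mathcal P$. A pair $(A,B)<(C,D)$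 is strongly $\mathcal P$-relevant if there are $O,P,Q\in\mathcal P$ such that $\{A,B\}$ efficiently distinguishes $O$ and $P$ with $(A,B)\in P$, and $\{C,D\}$ efficiently distinguishes $P$ and $Q$ with $(D,C)\in P$. A strictly increasing sequence is strongly $\mathcal P$-relevant if every two consecutive members form a strongly $\mathcal P$-relevant pair. -}

module Defs where

open import Data.Nat using (ℕ; _≤_; _<_)
open import Data.Fin using (Fin)
open import Data.Bool using (Bool; T; _∧_; _∨_)
open import Data.Product using (Σ; ∃; ∃-syntax; _×_; _,_; proj₁; proj₂)
open import Data.Sum using (_⊎_)
open import Data.Empty using (⊥)
open import Relation.Nullary using (¬_)
open import Relation.Binary.PropositionalEquality using (_≡_)
open import Function.Bundles using (_↔_)
open import Level using (suc; zero)

record Graph : Set₁ where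
  field
    V     : Set
    E     : V → V → Set
    E-sym : ∀ {u v} → E u v → E v u
    E-irr : ∀ {v} → ¬ E v v

data Bound : Set where
  fin : ℕ → Bound
  ℵ₀  : Bound

module _ (G : Graph) where
  open Graph G

  VSet : Set
  VSet = V → Bool

  _≐_ : VSet → VSet → Set
  A ≐ B = ∀ v → A v ≡ B v

  _⊆_ : VSet → VSet → Set
  A ⊆ B = ∀ v → T (A v) → T (B v)

  -- Oriented separations (pairs (A , B)); an unordered separation {A,B}
  -- is represented by either of its orientations.
  OSep : Set
  OSep = VSet × VSet

  _≐o_ : OSep → OSep → Set
  (A , B) ≐o (C , D) = (A ≐ C) × (B ≐ D)

  SameSep : OSep → OSep → Set
  SameSep (A , B) (C , D) = ((A ≐ C) × (B ≐ D)) ⊎ ((A ≐ D) × (B ≐ C))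

  swap : OSep → OSep
  swap (A , B) = (B , A)

  IsSep : OSep → Set
  IsSep (A , B) =
    (∀ v → T (A v ∨ B v)) ×
    (∀ u v → T (A u) → ¬ T (B u) → T (B v) → ¬ T (A v) → ¬ E u v)

  IsProper : OSep → Set
  IsProper (A , B) = ¬ (∀ v → T (A v)) × ¬ (∀ v → T (B v))

  HasOrder : OSep → ℕ → Set
  HasOrder (A , B) n = Fin n ↔ Σ V (λ v → T (A v ∧ B v))

  OrderLt : OSep → Bound → Set
  OrderLt s (fin m) = Σ ℕ λ n → HasOrder s n × n < m
  OrderLt s ℵ₀      = Σ ℕ λ n → HasOrder s n

  _≤o_ : OSep → OSep → Set
  (A , B) ≤o (C , D) = (A ⊆ C) × (D ⊆ B)

  _<o_ : OSep → OSep → Set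
  s <o t = (s ≤o t) × ¬ (s ≐o t)

  OSepSet : Set₁
  OSepSet = OSep → Set

  Respects≐ : OSepSet → Set
  Respects≐ O = ∀ s t → s ≐o t → O s → O t

  Consistent : OSepSet → Set
  Consistent O = ¬ (Σ OSep λ s → Σ OSep λ t →
                      O s × O t × ¬ SameSep s t × (swap s ≤o t))

  IsPreTangleOf : Bound → OSepSet → Set
  IsPreTangleOf k P =
    Respects≐ P ×
    Consistent P ×
    (∀ s → P s → IsSep s × OrderLt s k) ×
    (∀ s → IsSep s → OrderLt s k →
        (P s ⊎ P (swap s)) ×
        (¬ (s ≐o swap s) → ¬ (P s × P (swap s))))

  IsPreTangle : OSepSet → Set
  IsPreTangle P = Σ Bound λ k → IsPreTangleOf k P

  Distinguishes : OSep → OSepSet → OSepSet → Set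
  Distinguishes s P Q =
    IsSep s × ¬ (s ≐o swap s) ×
    ((P s × Q (swap s)) ⊎ (P (swap s) × Q s))

  EffDistinguishes : OSep → OSepSet → OSepSet → Set
  EffDistinguishes s P Q =
    Distinguishes s P Q ×
    Σ ℕ λ n → HasOrder s n ×
      (∀ t → Distinguishes t P Q → ∀ m → HasOrder t m → n ≤ m)

  PreTangleSet : Set₂
  PreTangleSet = OSepSet → Set₁

  IsPreTangleSet : PreTangleSet → Set₁
  IsPreTangleSet 𝒫 = ∀ P → 𝒫 P → IsPreTangle P

  -- A set N of (unordered) separations, represented as a set of oriented
  -- separations closed under swapping; then N⃗ = {s | N s}.
  IsSepSet : OSepSet → Set
  IsSepSet N = Respects≐ N × (∀ s → N s → N (swap s))

  Nested : OSepSet → Set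
  Nested N = ∀ s t → N s → N t →
    (s ≤o t) ⊎ (s ≤o swap t) ⊎ (swap s ≤o t) ⊎ (swap s ≤o swap t)

  Relevant : PreTangleSet → OSep → Set₁
  Relevant 𝒫 s = Σ OSepSet λ P → Σ OSepSet λ Q →
    𝒫 P × 𝒫 Q × EffDistinguishes s P Q

  EffDistinguishesSet : OSepSet → PreTangleSet → Set₁
  EffDistinguishesSet N 𝒫 = ∀ P Q → 𝒫 P → 𝒫 Q →
    (Σ OSep λ t → Distinguishes t P Q) →
    Σ OSep λ s → N s × EffDistinguishes s P Q

  StronglyRelevantPair : PreTangleSet → OSep → OSep → Set₁
  StronglyRelevantPair 𝒫 s t =
    (s <o t) ×
    Σ OSepSet λ O → Σ OSepSet λ P → Σ OSepSet λ Q →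
      𝒫 O × 𝒫 P × 𝒫 Q ×
      EffDistinguishes s O P × P s ×
      EffDistinguishes t P Q × P (swap t)

  StrictlyIncreasing : (ℕ → OSep) → Set
  StrictlyIncreasing f = ∀ i → f i <o f (Data.Nat.suc i)

  StronglyRelevantSeq : PreTangleSet → (ℕ → OSep) → Set₁
  StronglyRelevantSeq 𝒫 f = ∀ i → StronglyRelevantPair 𝒫 (f i) (f (Data.Nat.suc i))

  IsSubsequence : (ℕ → OSep) → (ℕ → OSep) → Set
  IsSubsequence s t = Σ (ℕ → ℕ) λ φ →
    (∀ i → φ i < φ (Data.Nat.suc i)) × (∀ i → t (φ i) ≐o s i)

{-# OPTIONS --safe #-}
-- Write x* for the inverse orientation of x. Let a < b be consecutive members of the
-- sequence, with |a| < |b|. Orient the witnesses of relevance so that a efficiently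
-- distinguishes O ∋ a* from P′ ∋ a, and b efficiently distinguishes P ∋ b* from Q ∋ b.
-- Since P and Q agree below |b| and Q is consistent, P ∋ a, so a distinguishes O from P;
-- let r ∈ N distinguish them efficiently. If |r| = |a| then a itself does, and (a, b) is
-- strongly relevant via O, P, Q. Otherwise |r| < |a|, and consistency of O, P′, P, Q together
-- with nestedness and properness of a place r strictly between a and b, with (a, r) strongly
-- relevant via O, P′, P and (r, b) via O, P, Q. Inserting these intermediate separations into
-- the sequence gives the required refinement.
module Submission where

open import Defs
open import Level using (_⊔_)
open import Data.Nat using (ℕ; suc; zero; _<_; _≤_)
open import Data.Nat.Properties
  using (≤-antisym; <⇒≢; >⇒≢; <⇒≱; ≮⇒≥; <-trans; ≤-<-trans; <-≤-trans; <⇒≤; n<1+n; m<n⇒m<1+n; m≤n⇒m<n∨m≡n; _<?_)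
open import Data.Product using (Σ; _×_; _,_; proj₁; proj₂)
open import Data.Product.Function.Dependent.Propositional using (Σ-↔)
open import Data.Sum using (_⊎_; inj₁; inj₂; [_,_]′)
open import Data.Bool using (T; _∧_)
open import Data.Bool.Properties using (∧-comm; ∨-comm; T-∨)
open import Data.Empty using (⊥-elim)
open import Data.Fin using (Fin)
open import Data.Fin.Properties using (injective⇒≤)
open import Function using (_∘_)
open import Function.Bundles using (_↔_; Injection; Equivalence)
open import Function.Properties.Inverse using (↔-refl; ↔-sym; ↔-trans; ↔⇒↣)
open import Relation.Nullary using (¬_; yes; no)
open import Relation.Binary.PropositionalEquality
  using (_≡_; _≢_; refl; cong; cong₂; subst; module ≡-Reasoning)

module _ (G : Graph) where
  open Graph G

  infix 4 _⊑_
  _⊑_ : OSep G → OSep G → Set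
  _⊑_ = _≤o_ G

  Fin↔⇒≤ : ∀ {m n} → Fin m ↔ Fin n → m ≤ n
  Fin↔⇒≤ e = injective⇒≤ (Injection.injective (↔⇒↣ e))

  HasOrder-unique : ∀ s {m n} → HasOrder G s m → HasOrder G s n → m ≡ n
  HasOrder-unique s hm hn =
    ≤-antisym (Fin↔⇒≤ (↔-trans hm (↔-sym hn))) (Fin↔⇒≤ (↔-trans hn (↔-sym hm)))

  HasOrder-cong : ∀ s t {n} → (∀ v → (proj₁ s v ∧ proj₂ s v) ≡ (proj₁ t v ∧ proj₂ t v)) →
    HasOrder G s n → HasOrder G t n
  HasOrder-cong s t s∩≡t∩ hs = ↔-trans hs (Σ-↔ ↔-refl (λ {v} → T-cong (s∩≡t∩ v)))
    where
    T-cong : ∀ {x y} → x ≡ y → T x ↔ T y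
    T-cong refl = ↔-refl

  HasOrder-swap : ∀ s {n} → HasOrder G s n → HasOrder G (swap G s) n
  HasOrder-swap s = HasOrder-cong s (swap G s) (λ v → ∧-comm (proj₁ s v) (proj₂ s v))

  HasOrder-SameSep : ∀ s t {n} → SameSep G s t → HasOrder G s n → HasOrder G t n
  HasOrder-SameSep s t (inj₁ (A≐C , B≐D)) = HasOrder-cong s t (λ v → cong₂ _∧_ (A≐C v) (B≐D v))
  HasOrder-SameSep s t (inj₂ (A≐D , B≐C)) =
    HasOrder-swap (swap G t) ∘ HasOrder-cong s (swap G t) (λ v → cong₂ _∧_ (A≐D v) (B≐C v))

  order-≢⇒¬SameSep : ∀ s t {m n} → HasOrder G s m → HasOrder G t n → m ≢ n → ¬ SameSep G s t
  order-≢⇒¬SameSep s t hs ht m≢n s~t = m≢n (HasOrder-unique t (HasOrder-SameSep s t s~t hs) ht)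

  order-≢⇒<o : ∀ s t {m n} → HasOrder G s m → HasOrder G t n → m ≢ n → s ⊑ t → _<o_ G s t
  order-≢⇒<o s t hs ht m≢n s⊑t = s⊑t , order-≢⇒¬SameSep s t hs ht m≢n ∘ inj₁

  ≡⇒≐o : ∀ {s t} → s ≡ t → _≐o_ G s t
  ≡⇒≐o refl = (λ _ → refl) , (λ _ → refl)

  ⊑-trans : ∀ r s t → r ⊑ s → s ⊑ t → r ⊑ t
  ⊑-trans r s t (A⊆C , D⊆B) (C⊆E , F⊆D) = (λ v → C⊆E v ∘ A⊆C v) , (λ v → D⊆B v ∘ F⊆D v)

  swap-antitone : ∀ s t → s ⊑ t → swap G t ⊑ swap G s
  swap-antitone s t (A⊆C , D⊆B) = D⊆B , A⊆C

  ⊑-both⇒¬IsProper : ∀ a b → IsSep G b → a ⊑ b → a ⊑ swap G b → ¬ IsProper G a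
  ⊑-both⇒¬IsProper a b (covers , _) (_ , Bb⊆Ba) (_ , Ab⊆Ba) (_ , Ba≠V) =
    Ba≠V (λ v → [ Ab⊆Ba v , Bb⊆Ba v ]′ (Equivalence.to T-∨ (covers v)))

  IsSep-swap : ∀ s → IsSep G s → IsSep G (swap G s)
  IsSep-swap (A , B) (covers , no-edge) =
    (λ v → subst T (∨-comm (A v) (B v)) (covers v)) ,
    (λ u v Bu ¬Au Av ¬Bv uv → no-edge v u Av ¬Bv Bu ¬Au (E-sym uv))

  ≐o-swap : ∀ s → ¬ _≐o_ G s (swap G s) → ¬ _≐o_ G (swap G s) (swap G (swap G s))
  ≐o-swap s s≠s* (A≐B , B≐A) = s≠s* (B≐A , A≐B)

  Distinguishes-sym : ∀ s P Q → Distinguishes G s P Q → Distinguishes G s Q P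
  Distinguishes-sym s P Q (sep , s≠s* , inj₁ (Ps , Qs*)) = sep , s≠s* , inj₂ (Qs* , Ps)
  Distinguishes-sym s P Q (sep , s≠s* , inj₂ (Ps* , Qs)) = sep , s≠s* , inj₁ (Qs , Ps*)

  Distinguishes-swap : ∀ s P Q → Distinguishes G s P Q → Distinguishes G (swap G s) P Q
  Distinguishes-swap s P Q (sep , s≠s* , sides) =
    IsSep-swap s sep , ≐o-swap s s≠s* , [ inj₂ , inj₁ ]′ sides

  Distinguishes-orientsʳ : ∀ s P Q → Distinguishes G s P Q → Q s ⊎ Q (swap G s)
  Distinguishes-orientsʳ s P Q (_ , _ , inj₁ (_ , Qs*)) = inj₂ Qs*
  Distinguishes-orientsʳ s P Q (_ , _ , inj₂ (_ , Qs)) = inj₁ Qs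

  Distinguishes-orientsˡ : ∀ s P Q → Distinguishes G s P Q → P s ⊎ P (swap G s)
  Distinguishes-orientsˡ s P Q = Distinguishes-orientsʳ s Q P ∘ Distinguishes-sym s P Q

  Distinguishes-split : ∀ u X Y Z → Distinguishes G u X Y → Z u ⊎ Z (swap G u) →
    Distinguishes G u Z X ⊎ Distinguishes G u Z Y
  Distinguishes-split u X Y Z (sep , u≠u* , inj₁ (Xu , Yu*)) (inj₁ Zu) = inj₂ (sep , u≠u* , inj₁ (Zu , Yu*))
  Distinguishes-split u X Y Z (sep , u≠u* , inj₁ (Xu , Yu*)) (inj₂ Zu*) = inj₁ (sep , u≠u* , inj₂ (Zu* , Xu))
  Distinguishes-split u X Y Z (sep , u≠u* , inj₂ (Xu* , Yu)) (inj₁ Zu) = inj₁ (sep , u≠u* , inj₁ (Zu , Xu*))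
  Distinguishes-split u X Y Z (sep , u≠u* , inj₂ (Xu* , Yu)) (inj₂ Zu*) = inj₂ (sep , u≠u* , inj₂ (Zu* , Yu))

  EffDistinguishes-sym : ∀ s P Q → EffDistinguishes G s P Q → EffDistinguishes G s Q P
  EffDistinguishes-sym s P Q (d , n , hs , minimal) =
    Distinguishes-sym s P Q d , n , hs , λ t → minimal t ∘ Distinguishes-sym t Q P

  EffDistinguishes-swap : ∀ s P Q → EffDistinguishes G s P Q → EffDistinguishes G (swap G s) P Q
  EffDistinguishes-swap s P Q (d , n , hs , minimal) =
    Distinguishes-swap s P Q d , n , HasOrder-swap s hs , minimal

  EffDistinguishes-minimal : ∀ s P Q {n} → EffDistinguishes G s P Q → HasOrder G s n →
    ∀ t {m} → Distinguishes G t P Q → HasOrder G t m → n ≤ m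
  EffDistinguishes-minimal s P Q (_ , n′ , hs′ , minimal) hs t dt ht
    rewrite HasOrder-unique s hs hs′ = minimal t dt _ ht

  EffDistinguishes-≮ : ∀ s P Q {n} → EffDistinguishes G s P Q → HasOrder G s n →
    ∀ t {m} → Distinguishes G t P Q → HasOrder G t m → ¬ m < n
  EffDistinguishes-≮ s P Q es hs t dt ht m<n = <⇒≱ m<n (EffDistinguishes-minimal s P Q es hs t dt ht)

  PreTangle-orients : ∀ X → IsPreTangle G X → ∀ s {n} → X s → HasOrder G s n →
    ∀ r {m} → IsSep G r → HasOrder G r m → m ≤ n → X r ⊎ X (swap G r)
  PreTangle-orients X (k , _ , _ , bounded , orients) s {n} Xs hs r {m} sep hr m≤n =
    proj₁ (orients r sep (OrderLt-≤ k (proj₂ (bounded s Xs))))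
    where
    OrderLt-≤ : ∀ k → OrderLt G s k → OrderLt G r k
    OrderLt-≤ (fin K) (n′ , hs′ , n′<K) rewrite HasOrder-unique s hs′ hs = m , hr , ≤-<-trans m≤n n′<K
    OrderLt-≤ ℵ₀ _ = m , hr

  PreTangle-orients± : ∀ X → IsPreTangle G X → ∀ s {n} → X s ⊎ X (swap G s) → HasOrder G s n →
    ∀ r {m} → IsSep G r → HasOrder G r m → m ≤ n → X r ⊎ X (swap G r)
  PreTangle-orients± X hX s (inj₁ Xs) hs = PreTangle-orients X hX s Xs hs
  PreTangle-orients± X hX s (inj₂ Xs*) hs = PreTangle-orients X hX (swap G s) Xs* (HasOrder-swap s hs)

  PreTangle-⋢ : ∀ X → IsPreTangle G X → ∀ c d {m n} → X (swap G c) → X d →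
    HasOrder G c m → HasOrder G d n → m ≢ n → ¬ c ⊑ d
  PreTangle-⋢ X (_ , _ , consistent , _) c d Xc* Xd hc hd m≢n c⊑d =
    consistent (swap G c , d , Xc* , Xd , order-≢⇒¬SameSep (swap G c) d (HasOrder-swap c hc) hd m≢n , c⊑d)

  EffDistinguishes⇒agree-below : ∀ X Y → IsPreTangle G Y → ∀ b {n} → EffDistinguishes G b X Y →
    HasOrder G b n → ∀ r {m} → IsSep G r → ¬ _≐o_ G r (swap G r) → HasOrder G r m → m < n →
    X r → Y r
  EffDistinguishes⇒agree-below X Y hY b eb hb r sep r≠r* hr m<n Xr
    with PreTangle-orients± Y hY b (Distinguishes-orientsʳ b X Y (proj₁ eb)) hb r sep hr (<⇒≤ m<n)
  ... | inj₁ Yr = Yr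
  ... | inj₂ Yr* = ⊥-elim (EffDistinguishes-≮ b X Y eb hb r (sep , r≠r* , inj₁ (Xr , Yr*)) hr m<n)

  EffDistinguishes-ultrametric : ∀ Z X Y → IsPreTangle G Z →
    ∀ x {nx} → EffDistinguishes G x Z X → HasOrder G x nx →
    ∀ y {ny} → EffDistinguishes G y Z Y → HasOrder G y ny → ny ≤ nx →
    ∀ u {m} → Distinguishes G u X Y → HasOrder G u m → ny ≤ m
  EffDistinguishes-ultrametric Z X Y hZ x ex hx y {ny} ey hy ny≤nx u {m} du hu with m <? ny
  ... | no m≮ny = ≮⇒≥ m≮ny
  ... | yes m<ny with Distinguishes-split u X Y Z du
         (PreTangle-orients± Z hZ x (Distinguishes-orientsˡ x Z X (proj₁ ex)) hx u (proj₁ du) hu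
           (<⇒≤ (<-≤-trans m<ny ny≤nx)))
  ...   | inj₁ dZX = ⊥-elim (EffDistinguishes-≮ x Z X ex hx u dZX hu (<-≤-trans m<ny ny≤nx))
  ...   | inj₂ dZY = ⊥-elim (EffDistinguishes-≮ y Z Y ey hy u dZY hu m<ny)

  EffDistinguishes⇒points-up : ∀ P Q → IsPreTangle G P → IsPreTangle G Q →
    ∀ b {n} → EffDistinguishes G b P Q → HasOrder G b n → P (swap G b) → Q b →
    ∀ a {m} → IsSep G a → ¬ _≐o_ G a (swap G a) → HasOrder G a m → m < n → a ⊑ b → P a
  EffDistinguishes⇒points-up P Q hP hQ b eb hb Pb* Qb a sep a≠a* ha m<n a⊑b
    with PreTangle-orients P hP (swap G b) Pb* (HasOrder-swap b hb) a sep ha (<⇒≤ m<n)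
  ... | inj₁ Pa = Pa
  ... | inj₂ Pa* = ⊥-elim (PreTangle-⋢ Q hQ a b Qa* Qb ha hb (<⇒≢ m<n) a⊑b)
    where
    Qa* : Q (swap G a)
    Qa* = EffDistinguishes⇒agree-below P Q hQ b eb hb (swap G a) (IsSep-swap a sep) (≐o-swap a a≠a*)
            (HasOrder-swap a ha) m<n Pa*

module Interpolation {a ℓ r} {X : Set a} (Q : X → Set ℓ) (R : X → X → Set r) where

  Bridged : X → X → Set (a ⊔ ℓ ⊔ r)
  Bridged x y = R x y ⊎ Σ X λ z → Q z × R x z × R z y

  interpolate : (s : ℕ → X) → (∀ i → Q (s i)) → (∀ i → Bridged (s i) (s (suc i))) →
    Σ (ℕ → X) λ t → (∀ n → Q (t n)) × (∀ n → R (t n) (t (suc n))) ×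
      Σ (ℕ → ℕ) λ φ → (∀ i → φ i < φ (suc i)) × (∀ i → t (φ i) ≡ s i)
  interpolate s s∈Q bridge = at ∘ pos , at∈Q ∘ pos , R-at-next ∘ pos , φ , φ-increasing , cong at ∘ pos-φ
    where
    data Position : Set (a ⊔ ℓ ⊔ r) where
      original : ℕ → Position
      inserted : (i : ℕ) → Σ X (λ z → Q z × R (s i) z × R z (s (suc i))) → Position

    at : Position → X
    at (original i) = s i
    at (inserted i (z , _)) = z

    after : ∀ i → Bridged (s i) (s (suc i)) → Position
    after i (inj₁ _) = original (suc i)
    after i (inj₂ z) = inserted i z

    next : Position → Position
    next (original i) = after i (bridge i)
    next (inserted i _) = original (suc i)

    pos : ℕ → Position
    pos zero = original zero
    pos (suc n) = next (pos n)

    at∈Q : ∀ p → Q (at p)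
    at∈Q (original i) = s∈Q i
    at∈Q (inserted i (_ , z∈Q , _)) = z∈Q

    R-at-after : ∀ i b → R (s i) (at (after i b))
    R-at-after i (inj₁ R-step) = R-step
    R-at-after i (inj₂ (_ , _ , R-in , _)) = R-in

    R-at-next : ∀ p → R (at p) (at (next p))
    R-at-next (original i) = R-at-after i (bridge i)
    R-at-next (inserted i (_ , _ , _ , R-out)) = R-out

    stride : ∀ {i} → Bridged (s i) (s (suc i)) → ℕ → ℕ
    stride (inj₁ _) n = suc n
    stride (inj₂ _) n = suc (suc n)

    φ : ℕ → ℕ
    φ zero = zero
    φ (suc i) = stride (bridge i) (φ i)

    φ-increasing : ∀ i → φ i < φ (suc i)
    φ-increasing i with bridge i
    ... | inj₁ _ = n<1+n (φ i)
    ... | inj₂ _ = m<n⇒m<1+n (n<1+n (φ i))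

    stride-lands : ∀ i b → bridge i ≡ b → ∀ n → pos n ≡ original i → pos (stride b n) ≡ original (suc i)
    stride-lands i (inj₁ R-step) bridge≡b n pos≡i = begin
      next (pos n)           ≡⟨ cong next pos≡i ⟩
      after i (bridge i)     ≡⟨ cong (after i) bridge≡b ⟩
      original (suc i)       ∎
      where open ≡-Reasoning
    stride-lands i (inj₂ z) bridge≡b n pos≡i = begin
      next (next (pos n))         ≡⟨ cong (next ∘ next) pos≡i ⟩
      next (after i (bridge i))   ≡⟨ cong (next ∘ after i) bridge≡b ⟩
      original (suc i)            ∎
      where open ≡-Reasoning

    pos-φ : ∀ i → pos (φ i) ≡ original i
    pos-φ zero = refl
    pos-φ (suc i) = stride-lands i (bridge i) refl (φ i) (pos-φ i)

module Refinement (G : Graph) (𝒫 : PreTangleSet G) (N : OSepSet G)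
  (h𝒫 : IsPreTangleSet G 𝒫) (hN : IsSepSet G N)
  (hrel : ∀ s → N s → IsSep G s × IsProper G s × Relevant G 𝒫 s)
  (hnest : Nested G N) (heff : EffDistinguishesSet G N 𝒫) where

  open Interpolation N (StronglyRelevantPair G 𝒫) using (Bridged)

  record OrientedDistinguisher (X Y : OSepSet G) : Set₁ where
    field
      sep   : OSep G
      sep∈N : N sep
      eff   : EffDistinguishes G sep X Y
      X∋sep* : X (swap G sep)
      Y∋sep  : Y sep

  record OrientedRelevance (x : OSep G) : Set₁ where
    field
      Lo Hi  : OSepSet G
      Lo∈𝒫   : 𝒫 Lo
      Hi∈𝒫   : 𝒫 Hi
      eff    : EffDistinguishes G x Lo Hi
      Lo∋x*  : Lo (swap G x)
      Hi∋x   : Hi x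

  relevant-oriented : ∀ x → N x → OrientedRelevance x
  relevant-oriented x Nx with proj₂ (proj₂ (hrel x Nx))
  ... | P , Q , P∈𝒫 , Q∈𝒫 , ex@((_ , _ , inj₁ (Px , Qx*)) , _) =
    record { Lo∈𝒫 = Q∈𝒫 ; Hi∈𝒫 = P∈𝒫 ; eff = EffDistinguishes-sym G x P Q ex ; Lo∋x* = Qx* ; Hi∋x = Px }
  ... | P , Q , P∈𝒫 , Q∈𝒫 , ex@((_ , _ , inj₂ (Px* , Qx)) , _) =
    record { Lo∈𝒫 = P∈𝒫 ; Hi∈𝒫 = Q∈𝒫 ; eff = ex ; Lo∋x* = Px* ; Hi∋x = Qx }

  oriented-distinguisher : ∀ X Y → 𝒫 X → 𝒫 Y → ∀ s → Distinguishes G s X Y → OrientedDistinguisher X Y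
  oriented-distinguisher X Y X∈𝒫 Y∈𝒫 s ds with heff X Y X∈𝒫 Y∈𝒫 (s , ds)
  ... | r , Nr , er@((_ , _ , inj₁ (Xr , Yr*)) , _) =
    record { sep∈N = proj₂ hN r Nr ; eff = EffDistinguishes-swap G r X Y er ; X∋sep* = Xr ; Y∋sep = Yr* }
  ... | r , Nr , er@((_ , _ , inj₂ (Xr* , Yr)) , _) =
    record { sep∈N = Nr ; eff = er ; X∋sep* = Xr* ; Y∋sep = Yr }

  module Bridge {a b ma mb} (Na : N a) (Nb : N b) (a<b : _<o_ G a b)
    (ha : HasOrder G a ma) (hb : HasOrder G b mb) (ma<mb : ma < mb) where

    open OrientedRelevance (relevant-oriented a Na)
      renaming (Lo to O; Hi to P′; Lo∈𝒫 to O∈𝒫; Hi∈𝒫 to P′∈𝒫; eff to ea; Lo∋x* to O∋a*; Hi∋x to P′∋a)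
    open OrientedRelevance (relevant-oriented b Nb)
      renaming (Lo to P; Hi to Q; Lo∈𝒫 to P∈𝒫; Hi∈𝒫 to Q∈𝒫; eff to eb; Lo∋x* to P∋b*; Hi∋x to Q∋b)

    hO : IsPreTangle G O
    hO = h𝒫 O O∈𝒫

    hP′ : IsPreTangle G P′
    hP′ = h𝒫 P′ P′∈𝒫

    hP : IsPreTangle G P
    hP = h𝒫 P P∈𝒫

    hQ : IsPreTangle G Q
    hQ = h𝒫 Q Q∈𝒫

    a-sep : IsSep G a
    a-sep = proj₁ (hrel a Na)

    a≠a* : ¬ _≐o_ G a (swap G a)
    a≠a* = proj₁ (proj₂ (proj₁ ea))

    P∋a : P a
    P∋a = EffDistinguishes⇒points-up G P Q hP hQ b eb hb P∋b* Q∋b a a-sep a≠a* ha ma<mb (proj₁ a<b)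

    a-distinguishes-O-P : Distinguishes G a O P
    a-distinguishes-O-P = a-sep , a≠a* , inj₂ (O∋a* , P∋a)

    open OrientedDistinguisher (oriented-distinguisher O P O∈𝒫 P∈𝒫 a a-distinguishes-O-P)
      renaming (sep to r; sep∈N to Nr; eff to er; X∋sep* to O∋r*; Y∋sep to P∋r)

    nr : ℕ
    nr = proj₁ (proj₂ er)

    hr : HasOrder G r nr
    hr = proj₁ (proj₂ (proj₂ er))

    r-sep : IsSep G r
    r-sep = proj₁ (proj₁ er)

    r≠r* : ¬ _≐o_ G r (swap G r)
    r≠r* = proj₁ (proj₂ (proj₁ er))

    nr≤ma : nr ≤ ma
    nr≤ma = EffDistinguishes-minimal G r O P er hr a a-distinguishes-O-P ha

    a-eff : nr ≡ ma → EffDistinguishes G a O P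
    a-eff nr≡ma = a-distinguishes-O-P , ma , ha ,
      λ u du m hu → subst (_≤ m) nr≡ma (EffDistinguishes-minimal G r O P er hr u du hu)

    module Below (nr<ma : nr < ma) where

      nr<mb : nr < mb
      nr<mb = <-trans nr<ma ma<mb

      P′∋r* : P′ (swap G r)
      P′∋r* = EffDistinguishes⇒agree-below G O P′ hP′ a ea ha (swap G r) (IsSep-swap G r r-sep)
                (≐o-swap G r r≠r*) (HasOrder-swap G r hr) nr<ma O∋r*

      Q∋r : Q r
      Q∋r = EffDistinguishes⇒agree-below G P Q hQ b eb hb r r-sep r≠r* hr nr<mb P∋r

      r-eff : EffDistinguishes G r P′ P
      r-eff = (r-sep , r≠r* , inj₂ (P′∋r* , P∋r)) , nr , hr ,
        λ u du _ hu → EffDistinguishes-ultrametric G O P′ P hO a ea ha r er hr (<⇒≤ nr<ma) u du hu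

      a⊑r : _≤o_ G a r
      a⊑r with hnest r a Nr Na
      ... | inj₁ r⊑a = ⊥-elim (PreTangle-⋢ G P′ hP′ r a P′∋r* P′∋a hr ha (<⇒≢ nr<ma) r⊑a)
      ... | inj₂ (inj₁ r⊑a*) =
        ⊥-elim (PreTangle-⋢ G O hO r (swap G a) O∋r* O∋a* hr (HasOrder-swap G a ha) (<⇒≢ nr<ma) r⊑a*)
      ... | inj₂ (inj₂ (inj₁ r*⊑a)) =
        ⊥-elim (PreTangle-⋢ G P hP (swap G r) a P∋r P∋a (HasOrder-swap G r hr) ha (<⇒≢ nr<ma) r*⊑a)
      ... | inj₂ (inj₂ (inj₂ r*⊑a*)) = swap-antitone G (swap G r) (swap G a) r*⊑a*

      r⊑b : _≤o_ G r b
      r⊑b with hnest r b Nr Nb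
      ... | inj₁ r⊑b = r⊑b
      ... | inj₂ (inj₁ r⊑b*) = ⊥-elim (⊑-both⇒¬IsProper G a b (proj₁ (hrel b Nb)) (proj₁ a<b)
              (⊑-trans G a r (swap G b) a⊑r r⊑b*) (proj₁ (proj₂ (hrel a Na))))
      ... | inj₂ (inj₂ (inj₁ r*⊑b)) =
        ⊥-elim (PreTangle-⋢ G Q hQ (swap G r) b Q∋r Q∋b (HasOrder-swap G r hr) hb (<⇒≢ nr<mb) r*⊑b)
      ... | inj₂ (inj₂ (inj₂ r*⊑b*)) =
        ⊥-elim (PreTangle-⋢ G P hP b r P∋b* P∋r hb hr (>⇒≢ nr<mb) (swap-antitone G (swap G r) (swap G b) r*⊑b*))

      a-r-strongly-relevant : StronglyRelevantPair G 𝒫 a r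
      a-r-strongly-relevant = order-≢⇒<o G a r ha hr (>⇒≢ nr<ma) a⊑r ,
        O , P′ , P , O∈𝒫 , P′∈𝒫 , P∈𝒫 , ea , P′∋a , r-eff , P′∋r*

      r-b-strongly-relevant : StronglyRelevantPair G 𝒫 r b
      r-b-strongly-relevant = order-≢⇒<o G r b hr hb (<⇒≢ nr<mb) r⊑b ,
        O , P , Q , O∈𝒫 , P∈𝒫 , Q∈𝒫 , er , P∋r , eb , P∋b*

    bridge : Bridged a b
    bridge with m≤n⇒m<n∨m≡n nr≤ma
    ... | inj₁ nr<ma = inj₂ (r , Nr , Below.a-r-strongly-relevant nr<ma , Below.r-b-strongly-relevant nr<ma)
    ... | inj₂ nr≡ma = inj₁ (a<b , O , P , Q , O∈𝒫 , P∈𝒫 , Q∈𝒫 , a-eff nr≡ma , P∋a , eb , P∋b*)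

lemma4p5 : (G : Graph) (𝒫 : PreTangleSet G) (N : OSepSet G) →
    IsPreTangleSet G 𝒫 →
    IsSepSet G N →
    (∀ s → N s → IsSep G s × IsProper G s × Relevant G 𝒫 s) →
    Nested G N →
    EffDistinguishesSet G N 𝒫 →
    (s : ℕ → OSep G) →
    (∀ i → N (s i)) →
    StrictlyIncreasing G s →
    (∀ i → Σ ℕ λ m → Σ ℕ λ n → HasOrder G (s i) m × HasOrder G (s (suc i)) n × m < n) →
    Σ (ℕ → OSep G) λ t →
      (∀ i → N (t i)) × StrictlyIncreasing G t × IsSubsequence G s t × StronglyRelevantSeq G 𝒫 t
lemma4p5 G 𝒫 N h𝒫 hN hrel hnest heff s s∈N s-increasing s-orders =
  let t , t∈N , t-relevant , φ , φ-increasing , tφ≡s = interpolate s s∈N bridge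
  in t , t∈N , proj₁ ∘ t-relevant , (φ , φ-increasing , ≡⇒≐o G ∘ tφ≡s) , t-relevant
  where
  open Refinement G 𝒫 N h𝒫 hN hrel hnest heff
  open Interpolation N (StronglyRelevantPair G 𝒫)
  bridge : ∀ i → Bridged (s i) (s (suc i))
  bridge i with s-orders i
  ... | _ , _ , hm , hn , m<n = Bridge.bridge (s∈N i) (s∈N (suc i)) (s-increasing i) hm hn m<n
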